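{- Let $c \in \mathbb{R}^d$ and $v_1, \dots, v_{n-1} \in \mathbb{R}^d$. Then the polytope in Z-representation $$\mathcal{P} = \langle c, [v_1, v_2, \dots, v_{n-1}], L_{n-1}\rangle_Z = \Big\{ c + \sum_{i=1}^{n-1}\Big(\prod_{k=i}^{n-1}\alpha_k\Big) v_i \;\Big|\; \alpha \in [-1,1]^{n-1}\Big\}$$ is always point symmetric (with respect to the center $c$).
   Context: For $c \in \mathbb{R}^d$, $G \in \mathbb{R}^{d \times h}$ and $\mathcal{E} \in \{0,1\}^{p \times h}$, the Z-representation $\langle c, G, \mathcal{E}\rangle_Z$ denotes the set $\{ c + \sum_{i=1}^h (\prod_{k=1}^p \alpha_k^{\mathcal{E}_{(k,i)}}) G_{(\cdot,i)} \mid \alpha \in [-1,1]^p\}$, where $G_{(\cdot,i)}$ is the $i$-th column of $G$. $L_m$ denotes the $m \times m$ lower triangular matrix filled with ones (entry $(k,i)$ equals $1$ iff $k \ge i$). -}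

module Defs where

open import Level using (Level; _⊔_) renaming (suc to lsuc)
open import Data.Nat using (ℕ; zero; suc; _≤ᵇ_)
open import Data.Fin using (Fin; toℕ) renaming (zero to fzero; suc to fsuc)
open import Data.Bool using (Bool; if_then_else_)
open import Data.Product using (Σ; _×_)
open import Relation.Binary using (Rel; IsTotalOrder)
open import Algebra.Bundles using (CommutativeRing)

-- An ordered commutative ring (ℝ is an instance).  The statement is made for
-- every such ring, in particular for ℝ.
record OrderedCommutativeRing (c ℓ₁ ℓ₂ : Level) : Set (lsuc (c ⊔ ℓ₁ ⊔ ℓ₂)) where
  field
    commutativeRing : CommutativeRing c ℓ₁
  open CommutativeRing commutativeRing public
  field
    _≤_          : Rel Carrier ℓ₂
    isTotalOrder : IsTotalOrder _≈_ _≤_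
    +-monoˡ-≤    : ∀ {x y} z → x ≤ y → (x + z) ≤ (y + z)
    *-nonneg     : ∀ {x y} → 0# ≤ x → 0# ≤ y → 0# ≤ (x * y)

module _ {c ℓ₁ ℓ₂} (R : OrderedCommutativeRing c ℓ₁ ℓ₂) where
  open OrderedCommutativeRing R

  Σ[_] : ∀ n → (Fin n → Carrier) → Carrier
  Σ[ zero ] f = 0#
  Σ[ suc n ] f = f fzero + Σ[ n ] (λ i → f (fsuc i))

  Π[_] : ∀ n → (Fin n → Carrier) → Carrier
  Π[ zero ] f = 1#
  Π[ suc n ] f = f fzero * Π[ n ] (λ i → f (fsuc i))

  InUnitInterval : Carrier → Set ℓ₂
  InUnitInterval a = ((- 1#) ≤ a) × (a ≤ 1#)

  pow01 : Carrier → Bool → Carrier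
  pow01 a e = if e then a else 1#

  _∈⟨_,_,_⟩Z : ∀ {d h p} → (Fin d → Carrier) → (Fin d → Carrier) →
               (Fin d → Fin h → Carrier) → (Fin p → Fin h → Bool) → Set (c ⊔ ℓ₁ ⊔ ℓ₂)
  _∈⟨_,_,_⟩Z {d} {h} {p} x cv G E =
    Σ (Fin p → Carrier) λ α →
      (∀ k → InUnitInterval (α k)) ×
      (∀ j → x j ≈ (cv j + Σ[ h ] (λ i → Π[ p ] (λ k → pow01 (α k) (E k i)) * G j i)))

  PointSymmetric : ∀ {d} {ℓ} → ((Fin d → Carrier) → Set ℓ) → (Fin d → Carrier) → Set (c ⊔ ℓ)
  PointSymmetric S cv = ∀ x → S x → S (λ j → (cv j + cv j) - x j)

L : ∀ m → Fin m → Fin m → Bool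
L m k i = toℕ i ≤ᵇ toℕ k

{-# OPTIONS --safe #-}
-- Every monomial of the polynomial map parametrising ⟨c, G, L⟩_Z contains
-- the last parameter α_m to the first power, because the last row of L is
-- all ones.  Replacing α_m by −α_m keeps α in the cube and negates every
-- monomial, so it maps the point c + s to c − s = 2c − (c + s).
module Submission where

open import Defs
open import Data.Nat using (ℕ; zero; suc)
open import Data.Nat.Properties using (≤⇒≤ᵇ)
open import Data.Bool using (Bool; true)
open import Data.Bool.Properties using (T-≡)
open import Data.Fin using (Fin; fromℕ) renaming (zero to fzero; suc to fsuc)
open import Data.Fin.Properties using (toℕ-fromℕ; toℕ≤pred[n]; suc-injective)
open import Data.Product using (_,_)
open import Data.Vec.Functional using (updateAt)
open import Data.Vec.Functional.Properties using (updateAt-updates; updateAt-minimal)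
open import Function using (id; _∘_; Equivalence)
open import Relation.Binary.Structures using (IsTotalOrder)
open import Relation.Binary.PropositionalEquality using (_≡_; _≢_; cong)
import Algebra.Properties.Group as GroupProperties
import Algebra.Properties.Ring as RingProperties
import Relation.Binary.Reasoning.Setoid as SetoidReasoning

updateAt-preserves : ∀ {a p} {A : Set a} (P : A → Set p) {n} {xs : Fin n → A} i {f : A → A} →
                     (∀ {x} → P x → P (f x)) → (∀ j → P (xs j)) → ∀ j → P (updateAt xs i f j)
updateAt-preserves P fzero    Pf Pxs fzero    = Pf (Pxs fzero)
updateAt-preserves P fzero    Pf Pxs (fsuc j) = Pxs (fsuc j)
updateAt-preserves P (fsuc i) Pf Pxs fzero    = Pxs fzero
updateAt-preserves P (fsuc i) Pf Pxs (fsuc j) = updateAt-preserves P i Pf (Pxs ∘ fsuc) j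

L-lastRow : ∀ n i → L (suc n) (fromℕ n) i ≡ true
L-lastRow n i rewrite toℕ-fromℕ n = Equivalence.to T-≡ (≤⇒≤ᵇ (toℕ≤pred[n] i))

module _ {c ℓ₁ ℓ₂} (R : OrderedCommutativeRing c ℓ₁ ℓ₂) where
  open OrderedCommutativeRing R
  open RingProperties ring using (-‿distribˡ-*; -‿distribʳ-*; -0#≈0#; -‿involutive; -‿+-comm)
  open GroupProperties +-group using (\\-leftDividesˡ)
  open IsTotalOrder isTotalOrder using (≲-respˡ-≈; ≲-respʳ-≈)
  open SetoidReasoning setoid

  neg-antitone : ∀ {x y} → x ≤ y → (- y) ≤ (- x)
  neg-antitone {x} {y} x≤y =
    ≲-respʳ-≈ (trans (+-congˡ (+-comm (- x) (- y))) (\\-leftDividesˡ y (- x)))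
      (≲-respˡ-≈ (\\-leftDividesˡ x (- y)) (+-monoˡ-≤ (- x + - y) x≤y))

  neg-inUnitInterval : ∀ {a} → InUnitInterval R a → InUnitInterval R (- a)
  neg-inUnitInterval (-1≤a , a≤1) =
    neg-antitone a≤1 , ≲-respʳ-≈ (-‿involutive 1#) (neg-antitone -1≤a)

  reflect-through : ∀ x s → (x + x) - (x + s) ≈ x + - s
  reflect-through x s = begin
    (x + x) + - (x + s)     ≈⟨ +-congˡ (-‿+-comm x s) ⟨
    (x + x) + (- x + - s)   ≈⟨ +-assoc x x (- x + - s) ⟩
    x + (x + (- x + - s))   ≈⟨ +-congˡ (\\-leftDividesˡ x (- s)) ⟩
    x + - s                 ∎

  Σ-cong : ∀ n {f g : Fin n → Carrier} → (∀ i → f i ≈ g i) → Σ[_] R n f ≈ Σ[_] R n g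
  Σ-cong zero    f≈g = refl
  Σ-cong (suc n) f≈g = +-cong (f≈g fzero) (Σ-cong n (f≈g ∘ fsuc))

  Σ-neg : ∀ n (f : Fin n → Carrier) → Σ[_] R n (λ i → - f i) ≈ - Σ[_] R n f
  Σ-neg zero    f = sym -0#≈0#
  Σ-neg (suc n) f = trans (+-congˡ (Σ-neg n (f ∘ fsuc))) (-‿+-comm (f fzero) _)

  Π-cong : ∀ n {f g : Fin n → Carrier} → (∀ i → f i ≈ g i) → Π[_] R n f ≈ Π[_] R n g
  Π-cong zero    f≈g = refl
  Π-cong (suc n) f≈g = *-cong (f≈g fzero) (Π-cong n (f≈g ∘ fsuc))

  Π-negateAt : ∀ n (f g : Fin n → Carrier) k → (∀ j → j ≢ k → f j ≈ g j) → f k ≈ - g k →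
               Π[_] R n f ≈ - Π[_] R n g
  Π-negateAt (suc n) f g fzero    f≈g fk≈-gk = begin
    f fzero * Π[_] R n (f ∘ fsuc)    ≈⟨ *-cong fk≈-gk (Π-cong n (λ j → f≈g (fsuc j) λ ())) ⟩
    - g fzero * Π[_] R n (g ∘ fsuc)  ≈⟨ -‿distribˡ-* (g fzero) _ ⟨
    - (g fzero * Π[_] R n (g ∘ fsuc)) ∎
  Π-negateAt (suc n) f g (fsuc k) f≈g fk≈-gk = begin
    f fzero * Π[_] R n (f ∘ fsuc)    ≈⟨ *-cong (f≈g fzero λ ()) tail-negated ⟩
    g fzero * - Π[_] R n (g ∘ fsuc)  ≈⟨ -‿distribʳ-* (g fzero) _ ⟨
    - (g fzero * Π[_] R n (g ∘ fsuc)) ∎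
    where
    tail-negated : Π[_] R n (f ∘ fsuc) ≈ - Π[_] R n (g ∘ fsuc)
    tail-negated = Π-negateAt n (f ∘ fsuc) (g ∘ fsuc) k
      (λ j j≢k → f≈g (fsuc j) (j≢k ∘ suc-injective)) fk≈-gk

  monomial : ∀ {p h} → (Fin p → Fin h → Bool) → (Fin p → Carrier) → Fin h → Carrier
  monomial {p} E α i = Π[_] R p (λ k → pow01 R (α k) (E k i))

  Z-pointSymmetric : ∀ {d h p} (cv : Fin d → Carrier) (G : Fin d → Fin h → Carrier)
                     (E : Fin p → Fin h → Bool) (σ : (Fin p → Carrier) → Fin p → Carrier) →
                     (∀ {α} → (∀ k → InUnitInterval R (α k)) → ∀ k → InUnitInterval R (σ α k)) →
                     (∀ α i → monomial E (σ α) i ≈ - monomial E α i) →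
                     PointSymmetric R (λ x → _∈⟨_,_,_⟩Z R x cv G E) cv
  Z-pointSymmetric {h = h} cv G E σ σ-cube σ-negates x (α , α-cube , x≈) =
    σ α , σ-cube α-cube , λ j → begin
      (cv j + cv j) - x j                            ≈⟨ +-congˡ (-‿cong (x≈ j)) ⟩
      (cv j + cv j) - (cv j + Σ[_] R h (term α j))   ≈⟨ reflect-through (cv j) _ ⟩
      cv j + - Σ[_] R h (term α j)                   ≈⟨ +-congˡ (Σ-neg h (term α j)) ⟨
      cv j + Σ[_] R h (λ i → - term α j i)           ≈⟨ +-congˡ (Σ-cong h (term-negated j)) ⟨
      cv j + Σ[_] R h (term (σ α) j)                 ∎
    where
    term : (Fin _ → Carrier) → ∀ j i → Carrier
    term β j i = monomial E β i * G j i

    term-negated : ∀ j i → term (σ α) j i ≈ - term α j i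
    term-negated j i = trans (*-congʳ (σ-negates α i)) (sym (-‿distribˡ-* _ (G j i)))

  Z-pointSymmetric-commonFactor : ∀ {d h p} (cv : Fin d → Carrier) (G : Fin d → Fin h → Carrier)
                                  (E : Fin p → Fin h → Bool) k → (∀ i → E k i ≡ true) →
                                  PointSymmetric R (λ x → _∈⟨_,_,_⟩Z R x cv G E) cv
  Z-pointSymmetric-commonFactor {p = p} cv G E k Ek≡true =
    Z-pointSymmetric cv G E negateₖ
      (updateAt-preserves (InUnitInterval R) k neg-inUnitInterval) negateₖ-negates
    where
    negateₖ : (Fin p → Carrier) → Fin p → Carrier
    negateₖ α = updateAt α k (-_)

    negateₖ-negates : ∀ α i → monomial E (negateₖ α) i ≈ - monomial E α i
    negateₖ-negates α i = Π-negateAt p _ _ k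
      (λ j j≢k → reflexive (cong (λ a → pow01 R a (E j i)) (updateAt-minimal j k α j≢k)))
      at-k
      where
      at-k : pow01 R (negateₖ α k) (E k i) ≈ - pow01 R (α k) (E k i)
      at-k rewrite Ek≡true i = reflexive (updateAt-updates k α)

corollary1 : ∀ {c ℓ₁ ℓ₂} (R : OrderedCommutativeRing c ℓ₁ ℓ₂) (d m : ℕ)
             (cv : Fin d → OrderedCommutativeRing.Carrier R)
             (V : Fin d → Fin m → OrderedCommutativeRing.Carrier R) →
             PointSymmetric R (λ x → _∈⟨_,_,_⟩Z R x cv V (L m)) cv
corollary1 R d zero    cv V = Z-pointSymmetric R cv V (L zero) id id (λ _ ())
corollary1 R d (suc n) cv V =
  Z-pointSymmetric-commonFactor R cv V (L (suc n)) (fromℕ n) (L-lastRow n)
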